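{- In every network one can order all of its cutedges into a sequence $(e_1,\dots,e_p)$ such that every path from the source to the sink visits the cutedges in this order.
   Context: A hypergraph consists of a vertex set and a multiset of nonempty vertex subsets (hyperedges). A path is a sequence $(u_1,e_1,u_2,\dots,u_p,e_p,u_{p+1})$ of pairwise distinct vertices $u_i$ and pairwise distinct hyperedges $e_i$ with $u_i,u_{i+1}\in e_i$; it goes from $u_1$ to $u_{p+1}$ and traverses the $e_i$. A network is a connected hypergraph with two distinguished distinct vertices, the source and the sink. A cutedge is a hyperedge traversed by every path from the source to the sink. -}

module Defs where

open import Data.Nat using (ℕ; suc)
open import Data.Fin using (Fin; inject₁) renaming (suc to fsuc)
open import Data.Fin.Subset using (Subset; _∈_; Nonempty)
open import Data.Vec using (Vec; lookup; toList)
open import Data.Product using (Σ; ∃; _×_)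
open import Data.List using (List)
open import Data.List.Relation.Unary.Unique.Propositional using (Unique)
open import Data.List.Relation.Binary.Sublist.Propositional using (_⊆_)
open import Data.List.Membership.Propositional renaming (_∈_ to _∈ˡ_)
open import Relation.Binary.PropositionalEquality using (_≡_; _≢_)
open import Function.Definitions using (Injective)
open import Function.Bundles using (_⇔_)

-- A finite hypergraph: vertices Fin n, hyperedges indexed by Fin m (so the
-- family of hyperedges is a multiset: distinct indices may carry equal sets),
-- each hyperedge a nonempty subset of the vertices.
record Hypergraph : Set where
  field
    nV    : ℕ
    nE    : ℕ
    edge  : Fin nE → Subset nV
    edge-nonempty : ∀ e → Nonempty (edge e)

module _ (H : Hypergraph) where
  open Hypergraph H

  record Path : Set where
    field
      len   : ℕ
      verts : Vec (Fin nV) (suc len)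
      edges : Vec (Fin nE) len
      verts-distinct : Injective _≡_ _≡_ (lookup verts)
      edges-distinct : Injective _≡_ _≡_ (lookup edges)
      step-left  : ∀ i → lookup verts (inject₁ i) ∈ edge (lookup edges i)
      step-right : ∀ i → lookup verts (fsuc i) ∈ edge (lookup edges i)

  PathFromTo : Fin nV → Fin nV → Path → Set
  PathFromTo u v P =
    (lookup (Path.verts P) Data.Fin.zero ≡ u) × (lookup (Path.verts P) (Data.Fin.fromℕ (Path.len P)) ≡ v)

  traversed : Path → List (Fin nE)
  traversed P = toList (Path.edges P)

  Connected : Set
  Connected = ∀ u v → Σ Path (PathFromTo u v)

record Network : Set where
  field
    hg        : Hypergraph
    connected : Connected hg
    source    : Fin (Hypergraph.nV hg)
    sink      : Fin (Hypergraph.nV hg)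
    source≢sink : source ≢ sink

module _ (N : Network) where
  open Network N

  STPath : Path hg → Set
  STPath = PathFromTo hg source sink

  IsCutedge : Fin (Hypergraph.nE hg) → Set
  IsCutedge e = ∀ (P : Path hg) → STPath P → e ∈ˡ traversed hg P

module Submission where

-- Fix a sink t and a hyperedge e.  `Reach k v` says that v reaches t by a walk
-- of at most k hyperedges, none of them e; it is decidable by recursion on k.
-- Two facts tie it to paths.  A segment of a path avoiding e transports
-- reachability backwards along the path (`segment-reach`).  Conversely a
-- shortest avoiding walk, which follows strictly decreasing distances to t,
-- repeats neither a vertex nor a hyperedge, so reachability yields a path
-- avoiding e (`avoidingPath`).  Hence e is a cutedge iff the source cannot
-- reach the sink within nV steps avoiding e, so cutedges are decidable.
-- If a cutedge a precedes b on a path P while b precedes a on a path Q, then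
-- "Q up to b, across b, then P to the sink" avoids a: impossible (`inversion`).
-- Consequently the list of cutedges along a source-sink path is the same for
-- every such path (`unique-lists-equal`, a fact about inversion-free lists);
-- it is duplicate-free, contains exactly the cutedges, and is a subsequence
-- of the hyperedge sequence of each source-sink path.

open import Defs
open import Data.Fin using (Fin)
open import Data.List using (List)
open import Data.Product using (Σ; _×_)
open import Function.Bundles using (_⇔_)
open import Data.List.Relation.Unary.Unique.Propositional using (Unique)
open import Data.List.Relation.Binary.Sublist.Propositional using (_⊆_)
open import Data.List.Membership.Propositional using (_∈_)

open import Data.Nat as ℕ using (ℕ; zero; suc; _+_; _∸_; z≤n; s≤s)
import Data.Nat.Properties as ℕP
import Data.Fin as F
open F using (inject₁; fromℕ; toℕ) renaming (zero to fz; suc to fs)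
import Data.Fin.Properties as FP
import Data.Fin.Subset as S
open import Data.Fin.Subset.Properties using (_∈?_)
open import Data.Vec using (Vec; []; _∷_; lookup; toList)
open import Data.List using ([]; _∷_; filter)
open import Data.List.Relation.Unary.Any using (here; there)
open import Data.List.Relation.Unary.All as All using ()
open import Data.List.Relation.Unary.AllPairs using ([]; _∷_)
open import Data.List.Relation.Binary.Sublist.Propositional
  using (_∷_; _∷ʳ_; ⊆-trans; to∈; from∈)
open import Data.List.Relation.Binary.Sublist.Propositional.Properties using (filter-⊆)
import Data.List.Relation.Unary.Unique.Propositional.Properties as Unique
import Data.List.Membership.Propositional.Properties as Membership
open import Data.Product using (_,_; proj₁; proj₂)
open import Data.Sum using (inj₁; inj₂; _⊎_)
open import Data.Empty using (⊥; ⊥-elim)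
open import Relation.Nullary using (¬_; Dec; yes; no)
open import Relation.Nullary.Decidable using (_×-dec_; _⊎-dec_; ¬?)
open import Relation.Binary.PropositionalEquality
  using (_≡_; _≢_; refl; sym; trans; cong; subst; subst₂)
open import Function.Bundles using (mk⇔; module Equivalence)

-- Two duplicate-free lists with the same elements, no two of which occur in
-- opposite orders, are equal.  This turns "same order on every path" into a
-- single list of cutedges.
unique-lists-equal : ∀ {A : Set} (xs ys : List A) → Unique xs → Unique ys →
  (∀ {z} → z ∈ xs → z ∈ ys) → (∀ {z} → z ∈ ys → z ∈ xs) →
  (∀ a b → (a ∷ b ∷ []) ⊆ xs → (b ∷ a ∷ []) ⊆ ys → ⊥) → xs ≡ ys
unique-lists-equal [] [] _ _ _ _ _ = refl
unique-lists-equal [] (y ∷ ys) _ _ _ ys⊆xs _ with ys⊆xs (here refl)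
... | ()
unique-lists-equal (x ∷ xs) [] _ _ xs⊆ys _ _ with xs⊆ys (here refl)
... | ()
unique-lists-equal (x ∷ xs) (y ∷ ys) (x∉xs ∷ uxs) (y∉ys ∷ uys) xs⊆ys ys⊆xs noInv
  with xs⊆ys (here refl)
... | here refl = cong (x ∷_) (unique-lists-equal xs ys uxs uys tail⊆ tail⊇ tailNoInv)
  where
  tail⊆ : ∀ {z} → z ∈ xs → z ∈ ys
  tail⊆ z∈ with xs⊆ys (there z∈)
  ... | here refl = ⊥-elim (All.lookup x∉xs z∈ refl)
  ... | there z∈ys = z∈ys
  tail⊇ : ∀ {z} → z ∈ ys → z ∈ xs
  tail⊇ z∈ with ys⊆xs (there z∈)
  ... | here refl = ⊥-elim (All.lookup y∉ys z∈ refl)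
  ... | there z∈xs = z∈xs
  tailNoInv : ∀ a b → (a ∷ b ∷ []) ⊆ xs → (b ∷ a ∷ []) ⊆ ys → ⊥
  tailNoInv a b p q = noInv a b (x ∷ʳ p) (y ∷ʳ q)
... | there x∈ys with ys⊆xs (here refl)
...   | here refl = ⊥-elim (All.lookup y∉ys x∈ys refl)
...   | there y∈xs = ⊥-elim (noInv x y (refl ∷ from∈ y∈xs) (refl ∷ from∈ x∈ys))

lookup∈toList : ∀ {A : Set} {n} (xs : Vec A n) i → lookup xs i ∈ toList xs
lookup∈toList (x ∷ xs) fz = here refl
lookup∈toList (x ∷ xs) (fs i) = there (lookup∈toList xs i)

∈toList⇒position : ∀ {A : Set} {n} (xs : Vec A n) {y} → y ∈ toList xs →
  Σ (Fin n) λ i → lookup xs i ≡ y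
∈toList⇒position (x ∷ xs) (here y≡x) = fz , sym y≡x
∈toList⇒position (x ∷ xs) (there y∈xs) with ∈toList⇒position xs y∈xs
... | i , xsᵢ≡y = fs i , xsᵢ≡y

ordered-positions : ∀ {A : Set} {n} (xs : Vec A n) {a b} → (a ∷ b ∷ []) ⊆ toList xs →
  Σ (Fin n) λ i → Σ (Fin n) λ j → i F.< j × lookup xs i ≡ a × lookup xs j ≡ b
ordered-positions (x ∷ xs) (.x ∷ʳ ab⊆xs) with ordered-positions xs ab⊆xs
... | i , j , i<j , xsᵢ≡a , xsⱼ≡b = fs i , fs j , s≤s i<j , xsᵢ≡a , xsⱼ≡b
ordered-positions (x ∷ xs) (a≡x ∷ b⊆xs) with ∈toList⇒position xs (to∈ b⊆xs)
... | j , xsⱼ≡b = fz , fs j , s≤s z≤n , sym a≡x , xsⱼ≡b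

injective⇒unique : ∀ {A : Set} {n} (xs : Vec A n) →
  (∀ i j → lookup xs i ≡ lookup xs j → i ≡ j) → Unique (toList xs)
injective⇒unique [] _ = []
injective⇒unique (x ∷ xs) inj =
  All.tabulate (λ y∈xs x≡y → x∉xs (∈toList⇒position xs y∈xs) x≡y)
  ∷ injective⇒unique xs (λ i j eq → FP.suc-injective (inj (fs i) (fs j) eq))
  where
  x∉xs : ∀ {y} → Σ _ (λ i → lookup xs i ≡ y) → x ≢ y
  x∉xs (i , xsᵢ≡y) x≡y with inj fz (fs i) (trans x≡y (sym xsᵢ≡y))
  ... | ()

module AvoidingReachability (H : Hypergraph) (t : Fin (Hypergraph.nV H))
                            (e : Fin (Hypergraph.nE H)) where
  open Hypergraph H

  Reach : ℕ → Fin nV → Set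
  Reach zero v = v ≡ t
  Reach (suc k) v = Reach k v ⊎ Σ (Fin nE) λ g → (g ≢ e) × (v S.∈ edge g) ×
                                  Σ (Fin nV) λ u → (u S.∈ edge g) × Reach k u

  reach? : ∀ k v → Dec (Reach k v)
  reach? zero v = v FP.≟ t
  reach? (suc k) v = reach? k v ⊎-dec FP.any? λ g →
    ¬? (g FP.≟ e) ×-dec (v ∈? edge g) ×-dec FP.any? (λ u → (u ∈? edge g) ×-dec reach? k u)

  ∈-edge : ∀ {v g h} → g ≡ h → v S.∈ edge g → v S.∈ edge h
  ∈-edge refl v∈g = v∈g

  via : ∀ {k u v} g → g ≢ e → v S.∈ edge g → u S.∈ edge g → Reach k u → Reach (suc k) v
  via g g≢e v∈g u∈g r = inj₂ (g , g≢e , v∈g , _ , u∈g , r)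

  weaken-+ : ∀ n {k v} → Reach k v → Reach (n + k) v
  weaken-+ zero r = r
  weaken-+ (suc n) r = inj₁ (weaken-+ n r)

  weaken : ∀ {a b v} → a ℕ.≤ b → Reach a v → Reach b v
  weaken {a} {b} a≤b r = subst (λ k → Reach k _) (ℕP.m∸n+n≡m a≤b) (weaken-+ (b ∸ a) r)

  Distance : ℕ → Fin nV → Set
  Distance d v = Reach d v × (∀ d' → d' ℕ.< d → ¬ Reach d' v)

  distance : ∀ k v → Reach k v → Σ ℕ λ d → Distance d v
  distance zero v r = zero , r , λ _ ()
  distance (suc k) v r with reach? k v
  ... | yes r' = distance k v r'
  ... | no ¬r = suc k , r , λ d' d'<sk r' → ¬r (weaken (ℕP.≤-pred d'<sk) r')

  distance-separates : ∀ {a b v w} → Distance a v → Reach b w → b ℕ.< a → v ≢ w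
  distance-separates (_ , minimal) rw b<a refl = minimal _ b<a rw

  -- A walk from v to t of length d along which the distance to t drops by one
  -- at each step.  Such a walk is automatically a path (see `shortestWalk`).
  record ShortestWalk (d : ℕ) (v : Fin nV) : Set where
    field
      verts : Vec (Fin nV) (suc d)
      edges : Vec (Fin nE) d
      starts : lookup verts fz ≡ v
      ends   : lookup verts (fromℕ d) ≡ t
      avoids : ∀ i → lookup edges i ≢ e
      dist   : ∀ i → Distance (d ∸ toℕ i) (lookup verts i)
      step-left  : ∀ i → lookup verts (inject₁ i) S.∈ edge (lookup edges i)
      step-right : ∀ i → lookup verts (fs i) S.∈ edge (lookup edges i)
      verts-distinct : ∀ i j → lookup verts i ≡ lookup verts j → i ≡ j
      edges-distinct : ∀ i j → lookup edges i ≡ lookup edges j → i ≡ j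

  -- Vertices are distinct since distances strictly decrease; a hyperedge g
  -- used again later would give a shortcut from v, contradicting minimality.
  shortestWalk : ∀ d v → Distance d v → ShortestWalk d v
  shortestWalk zero v dv = record
    { verts = v ∷ [] ; edges = [] ; starts = refl ; ends = proj₁ dv ; avoids = λ ()
    ; dist = λ { fz → dv } ; step-left = λ () ; step-right = λ ()
    ; verts-distinct = λ { fz fz _ → refl } ; edges-distinct = λ () }
  shortestWalk (suc d) v (inj₁ r , minimal) = ⊥-elim (minimal d ℕP.≤-refl r)
  shortestWalk (suc d) v dv@(inj₂ (g , g≢e , v∈g , u , u∈g , ru) , minimal) = record
    { verts = v ∷ W.verts ; edges = g ∷ W.edges ; starts = refl ; ends = W.ends
    ; avoids = λ { fz → g≢e ; (fs i) → W.avoids i }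
    ; dist = λ { fz → dv ; (fs i) → W.dist i }
    ; step-left = λ { fz → v∈g ; (fs i) → W.step-left i }
    ; step-right = λ { fz → subst (S._∈ edge g) (sym W.starts) u∈g ; (fs i) → W.step-right i }
    ; verts-distinct = verts-distinct ; edges-distinct = edges-distinct }
    where
    du : Distance d u
    du = ru , λ d' d'<d r → minimal (suc d') (s≤s d'<d) (via g g≢e v∈g u∈g r)
    module W = ShortestWalk (shortestWalk d u du)

    v∉W : ∀ j → v ≢ lookup W.verts j
    v∉W j = distance-separates dv (proj₁ (W.dist j)) (s≤s (ℕP.m∸n≤m d (toℕ j)))

    verts-distinct : ∀ i j → lookup (v ∷ W.verts) i ≡ lookup (v ∷ W.verts) j → i ≡ j
    verts-distinct fz fz _ = refl
    verts-distinct (fs i) (fs j) eq = cong fs (W.verts-distinct i j eq)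
    verts-distinct fz (fs j) eq = ⊥-elim (v∉W j eq)
    verts-distinct (fs i) fz eq = ⊥-elim (v∉W i (sym eq))

    -- Reusing g at position j would let v reach t in 1 + (d - (j + 1)) ≤ d steps.
    g∉W : ∀ j → g ≢ lookup W.edges j
    g∉W j g≡eⱼ = minimal (suc (d ∸ suc (toℕ j))) (s≤s shorter)
      (via g g≢e v∈g (∈-edge (sym g≡eⱼ) (W.step-right j))
                     (proj₁ (W.dist (fs j))))
      where
      shorter : suc (d ∸ suc (toℕ j)) ℕ.≤ d
      shorter = subst (ℕ._≤ d) (ℕP.+-∸-assoc 1 (FP.toℕ<n j)) (ℕP.m∸n≤m d (toℕ j))

    edges-distinct : ∀ i j → lookup (g ∷ W.edges) i ≡ lookup (g ∷ W.edges) j → i ≡ j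
    edges-distinct fz fz _ = refl
    edges-distinct (fs i) (fs j) eq = cong fs (W.edges-distinct i j eq)
    edges-distinct fz (fs j) eq = ⊥-elim (g∉W j eq)
    edges-distinct (fs i) fz eq = ⊥-elim (g∉W i (sym eq))

  avoidingPath : ∀ {k v} → Reach k v →
    Σ (Path H) λ P → PathFromTo H v t P × ¬ (e ∈ traversed H P)
  avoidingPath {k} {v} r with distance k v r
  ... | d , dv = P , (W.starts , W.ends) , e∉P
    where
    module W = ShortestWalk (shortestWalk d v dv)
    P : Path H
    P = record { len = d ; verts = W.verts ; edges = W.edges
               ; verts-distinct = λ {i} {j} → W.verts-distinct i j
               ; edges-distinct = λ {i} {j} → W.edges-distinct i j
               ; step-left = W.step-left ; step-right = W.step-right }
    e∉P : ¬ (e ∈ traversed H P)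
    e∉P e∈P with ∈toList⇒position W.edges e∈P
    ... | i , eᵢ≡e = W.avoids i eᵢ≡e

  segment-reach : ∀ {n} (vs : Vec (Fin nV) (suc n)) (es : Vec (Fin nE) n) →
    (∀ k → lookup vs (inject₁ k) S.∈ edge (lookup es k)) →
    (∀ k → lookup vs (fs k) S.∈ edge (lookup es k)) →
    (i j : Fin (suc n)) → i F.≤ j → (∀ k → i F.≤ k → k F.< j → lookup es k ≢ e) →
    ∀ {m} → Reach m (lookup vs j) → Reach (n + m) (lookup vs i)
  segment-reach {zero} (v ∷ []) [] _ _ fz fz _ _ r = r
  segment-reach {suc n} vs es _ _ fz fz _ _ r = weaken-+ (suc n) r
  segment-reach {suc n} (v ∷ vs) (g ∷ es) sl sr fz (fs j) _ avoid r =
    via g (avoid fz z≤n (s≤s z≤n)) (sl fz) (sr fz)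
      (segment-reach vs es (λ k → sl (fs k)) (λ k → sr (fs k)) fz j z≤n
        (λ k _ k<j → avoid (fs k) z≤n (s≤s k<j)) r)
  segment-reach {suc n} (v ∷ vs) (g ∷ es) sl sr (fs i) (fs j) (s≤s i≤j) avoid r =
    inj₁ (segment-reach vs es (λ k → sl (fs k)) (λ k → sr (fs k)) i j i≤j
      (λ k i≤k k<j → avoid (fs k) (s≤s i≤k) (s≤s k<j)) r)

  path-segment-reach : (P : Path H) (i j : Fin (suc (Path.len P))) → i F.≤ j →
    (∀ k → i F.≤ k → k F.< j → lookup (Path.edges P) k ≢ e) →
    ∀ {m} → Reach m (lookup (Path.verts P) j) → Reach (Path.len P + m) (lookup (Path.verts P) i)
  path-segment-reach P =
    segment-reach (Path.verts P) (Path.edges P) (Path.step-left P) (Path.step-right P)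

  path⇒reach : ∀ {v} (P : Path H) → PathFromTo H v t P → ¬ (e ∈ traversed H P) →
    Reach (Path.len P) v
  path⇒reach P (starts , ends) e∉P =
    subst₂ Reach (ℕP.+-identityʳ (Path.len P)) starts
      (path-segment-reach P fz (fromℕ (Path.len P)) z≤n
        (λ k _ _ eₖ≡e → e∉P (subst (_∈ traversed H P) eₖ≡e (lookup∈toList (Path.edges P) k)))
        ends)

module Cutedges (N : Network) where
  open Network N
  open Hypergraph hg
  open Path

  module Avoiding (a : Fin nE) = AvoidingReachability hg sink a
  open import Data.List.Membership.DecPropositional (FP._≟_ {nE}) using ()
    renaming (_∈?_ to _∈ˡ?_)

  reach⇒¬cutedge : ∀ a k → Avoiding.Reach a k source → ¬ IsCutedge N a
  reach⇒¬cutedge a k r cut with Avoiding.avoidingPath a r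
  ... | P , st , a∉P = a∉P (cut P st)

  -- Paths visit at most nV vertices, so it suffices to test reachability
  -- within nV steps.
  cutedge? : ∀ a → Dec (IsCutedge N a)
  cutedge? a with Avoiding.reach? a nV source
  ... | yes r = no (reach⇒¬cutedge a nV r)
  ... | no ¬r = yes λ P st → traversed-by P st
    where
    traversed-by : ∀ P → STPath N P → a ∈ traversed hg P
    traversed-by P st with a ∈ˡ? traversed hg P
    ... | yes a∈P = a∈P
    ... | no a∉P = ⊥-elim (¬r (Avoiding.weaken a len≤nV (Avoiding.path⇒reach a P st a∉P)))
      where
      len≤nV : len P ℕ.≤ nV
      len≤nV = ℕP.≤-trans (ℕP.n≤1+n _) (FP.injective⇒≤ (verts-distinct P))

  elsewhere-≢ : ∀ (P : Path hg) {a i k} → lookup (edges P) i ≡ a →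
    toℕ k ≢ toℕ i → lookup (edges P) k ≢ a
  elsewhere-≢ P eᵢ≡a k≢i eₖ≡a = k≢i (cong toℕ (edges-distinct P (trans eₖ≡a (sym eᵢ≡a))))

  -- A cutedge a and another hyperedge b are never met in opposite orders by
  -- two source-sink paths: otherwise Q up to b, then P from b on avoids a.
  inversion : ∀ a b → IsCutedge N a → ∀ P Q → STPath N P → STPath N Q →
    (a ∷ b ∷ []) ⊆ traversed hg P → (b ∷ a ∷ []) ⊆ traversed hg Q → ⊥
  inversion a b cut P Q (_ , endsP) (startsQ , _) ab⊆P ba⊆Q
    with ordered-positions (edges P) ab⊆P | ordered-positions (edges Q) ba⊆Q
  ... | iaP , ibP , a<bP , eP≡a , eP≡b | ibQ , iaQ , b<aQ , eQ≡b , eQ≡a =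
    reach⇒¬cutedge a _ (subst (Reach _) startsQ source-reaches) cut
    where
    open Avoiding a
    b≢a : b ≢ a
    b≢a b≡a = elsewhere-≢ P eP≡a (ℕP.>⇒≢ a<bP) (trans eP≡b b≡a)

    -- On P, from the start of b onwards, a no longer occurs.
    afterB : Reach (len P + 0) (lookup (verts P) (inject₁ ibP))
    afterB = path-segment-reach P (inject₁ ibP) (fromℕ (len P)) (FP.≤fromℕ _)
      (λ k b≤k _ → elsewhere-≢ P eP≡a
        (ℕP.>⇒≢ (ℕP.<-≤-trans a<bP (subst (ℕ._≤ toℕ k) (FP.toℕ-inject₁ ibP) b≤k))))
      endsP

    -- Cross from the start of b on Q to the start of b on P.
    atB : Reach (suc (len P + 0)) (lookup (verts Q) (inject₁ ibQ))
    atB = via b b≢a (∈-edge eQ≡b (step-left Q ibQ)) (∈-edge eP≡b (step-left P ibP)) afterB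

    -- On Q, a does not occur before b.
    source-reaches : Reach (len Q + suc (len P + 0)) (lookup (verts Q) fz)
    source-reaches = path-segment-reach Q fz (inject₁ ibQ) z≤n
      (λ k _ k<b → elsewhere-≢ Q eQ≡a
        (ℕP.<⇒≢ (ℕP.<-trans (subst (toℕ k ℕ.<_) (FP.toℕ-inject₁ ibQ) k<b) b<aQ)))
      atB

  cutedgesAlong : Path hg → List (Fin nE)
  cutedgesAlong P = filter cutedge? (traversed hg P)

  cutedgesAlong-unique : ∀ P → Unique (cutedgesAlong P)
  cutedgesAlong-unique P =
    Unique.filter⁺ cutedge? (injective⇒unique (edges P) (λ i j → edges-distinct P))

  ∈-cutedgesAlong : ∀ P → STPath N P → ∀ c → (c ∈ cutedgesAlong P) ⇔ IsCutedge N c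
  ∈-cutedgesAlong P st c = mk⇔
    (λ c∈ → proj₂ (Membership.∈-filter⁻ cutedge? {xs = traversed hg P} c∈))
    (λ cut → Membership.∈-filter⁺ cutedge? (cut P st) cut)

  cutedgesAlong-invariant : ∀ P Q → STPath N P → STPath N Q →
    cutedgesAlong P ≡ cutedgesAlong Q
  cutedgesAlong-invariant P Q stP stQ =
    unique-lists-equal (cutedgesAlong P) (cutedgesAlong Q)
      (cutedgesAlong-unique P) (cutedgesAlong-unique Q)
      (λ c∈ → fromCut Q stQ (toCut P stP c∈)) (λ c∈ → fromCut P stP (toCut Q stQ c∈))
      (λ a b ab⊆ ba⊆ → inversion a b (toCut P stP (to∈ ab⊆)) P Q stP stQ
         (⊆-trans ab⊆ (filter-⊆ cutedge? _)) (⊆-trans ba⊆ (filter-⊆ cutedge? _)))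
    where
    toCut : ∀ R → STPath N R → ∀ {c} → c ∈ cutedgesAlong R → IsCutedge N c
    toCut R st = Equivalence.to (∈-cutedgesAlong R st _)
    fromCut : ∀ R → STPath N R → ∀ {c} → IsCutedge N c → c ∈ cutedgesAlong R
    fromCut R st = Equivalence.from (∈-cutedgesAlong R st _)

mainTheorem10 : (N : Network) →
    Σ (List (Fin (Hypergraph.nE (Network.hg N)))) λ cs →
    Unique cs
    × (∀ e → (e ∈ cs) ⇔ IsCutedge N e)
    × (∀ (P : Path (Network.hg N)) → STPath N P → cs ⊆ traversed (Network.hg N) P)
mainTheorem10 N =
  cutedgesAlong P₀ , cutedgesAlong-unique P₀ , ∈-cutedgesAlong P₀ st₀ , subsequence
  where
  open Network N
  open Cutedges N
  -- Any source-sink path serves as reference; connectivity provides one.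
  P₀ : Path hg
  P₀ = proj₁ (connected source sink)
  st₀ : STPath N P₀
  st₀ = proj₂ (connected source sink)
  subsequence : ∀ P → STPath N P → cutedgesAlong P₀ ⊆ traversed hg P
  subsequence P st = subst (_⊆ traversed hg P) (cutedgesAlong-invariant P P₀ st st₀)
                           (filter-⊆ cutedge? (traversed hg P))
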